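{- Let $r\ge 1$ and $k\ge 1$ be integers, and let $\vec a,\vec b\in\mathcal H_{r,k}$ (respectively $\vec a, \vec b\in\mathcal H^*_{r,k}$) have disjoint support, i.e. $a_i\ne b_j$ for all $i,j\in\{1,\dots,k\}$. Then the Hanoi game on $\mathcal H_{r,k}$ (respectively on $\mathcal H^*_{r,k}$) with initial state $\vec a$ and final state $\vec b$ requires exactly $2^k-1$ moves to solve.
   Context: A Hanoi state is a finite sequence of nonnegative integers $\vec x=(x_1,\dots,x_k)$ with $x_i\ne x_{i-1}$ for all $i>1$. Let $\mathcal H_{r,k}$ be the set of Hanoi states in $\{0,1,\dots,r\}^k$, and let $\mathcal H^*_{r,k}\subset \mathcal H_{r,k}$ be the set of proper Hanoi states, i.e. those with $x_1\ne 0$. In the Hanoi game on $\mathcal H_{r,k}$, a state is transformed by moves of two types: (1) an adjustment of $\vec x$ changes $x_k$ to any other value in $\{0,1,\dots,r\}$ different from $x_{k-1}$ (when $k=1$, to any other value); (2) an involution of $\vec x$ (for $k\ge 2$) finds the longest tail segment $(x_j,\dots,x_k)$ of $\vec x$ on which the entries alternate between the values $x_k$ and $x_{k-1}$, and swaps the values $x_k$ and $x_{k-1}$ throughout that segment. The Hanoi game on $\mathcal H^*_{r,k}$ is the same, but with the requirement that all states involved be proper Hanoi states. "Solving" the game means transforming the initial state into the final state by a sequence of moves; the number of moves required is the minimum length of such a sequence. -}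

module Defs where

open import Data.Nat using (ℕ; zero; suc; _≤_; _≟_)
open import Data.List using (List; []; _∷_; _++_; [_]; length; reverse)
open import Data.List.Relation.Unary.All using (All)
open import Data.Product using (Σ; ∃; _×_; _,_)
open import Relation.Binary.PropositionalEquality using (_≡_; _≢_)
open import Relation.Nullary using (yes; no)

-- A state (x₁,…,x_k) is represented as the list x₁ ∷ … ∷ x_k ∷ [].

data NoAdjRepeat : List ℕ → Set where
  nil  : NoAdjRepeat []
  one  : ∀ x → NoAdjRepeat (x ∷ [])
  cons : ∀ {x y l} → x ≢ y → NoAdjRepeat (y ∷ l) → NoAdjRepeat (x ∷ y ∷ l)

record Hanoi (r k : ℕ) (x : List ℕ) : Set where
  field
    len   : length x ≡ k
    range : All (_≤ r) x
    noRep : NoAdjRepeat x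

data FirstNonzero : List ℕ → Set where
  fnz : ∀ {x l} → x ≢ 0 → FirstNonzero (x ∷ l)

ProperHanoi : ℕ → ℕ → List ℕ → Set
ProperHanoi r k x = Hanoi r k x × FirstNonzero x

-- altSwap p q l: on the maximal prefix of l of the form p,q,p,q,…,
-- exchange p and q; the rest is unchanged.
altSwap : ℕ → ℕ → List ℕ → List ℕ
altSwap p q [] = []
altSwap p q (z ∷ l) with z ≟ p
... | yes _ = q ∷ altSwap q p l
... | no  _ = z ∷ l

-- Involution: take the longest tail segment (x_j,…,x_k) alternating between
-- x_k and x_{k-1}, and swap these two values on it.  Working on the reversed
-- list, that segment is the maximal prefix x_k, x_{k-1}, x_k, …
involutionRev : List ℕ → List ℕ
involutionRev (y ∷ x ∷ l) = altSwap y x (y ∷ x ∷ l)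
involutionRev l = l

involution : List ℕ → List ℕ
involution x = reverse (involutionRev (reverse x))

-- One move of the Hanoi game (without the validity constraint on states).
data Move : List ℕ → List ℕ → Set where
  adjustment : ∀ (init : List ℕ) (x v : ℕ) → x ≢ v →
               Move (init ++ [ x ]) (init ++ [ v ])
  involve    : ∀ (a : List ℕ) → 2 ≤ length a → Move a (involution a)

data Solves (S : List ℕ → Set) : ℕ → List ℕ → List ℕ → Set where
  done : ∀ {a} → S a → Solves S 0 a a
  step : ∀ {n a b c} → S a → Move a b → Solves S n b c → Solves S (suc n) a c

RequiresExactly : (List ℕ → Set) → ℕ → List ℕ → List ℕ → Set
RequiresExactly S n a b = Solves S n a b × (∀ m → Solves S m a b → n ≤ m)

Disjoint : List ℕ → List ℕ → Set
Disjoint a b = All (λ x → All (λ y → x ≢ y) b) a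

-- Read a state backwards, so that the top entry x_k, the one adjustments change, is the head.
-- Adjustments leave the lower k − 1 entries alone, two consecutive involutions cancel, and an
-- involution following an adjustment moves the lower entries by exactly one move of the game
-- on k − 1 entries.  So a solution with n moves projects to a solution of the lower entries
-- with m moves where 2m + 1 ≤ n, whose endpoints are again disjoint; by induction
-- n ≥ 2^k − 1.  Conversely every move of the lower entries can be simulated by one adjustment
-- (bringing the top entry to the head of the next lower state) followed by one involution,
-- which gives a solution with 2(2^(k−1) − 1) + 1 = 2^k − 1 moves.
module Submission where

open import Defs
open import Data.Nat using (ℕ; zero; suc; _≤_; _∸_; _^_; _+_; _≟_; z≤n; s≤s)
open import Data.Nat.Properties
  using (≤-reflexive; ≤-trans; ≤-antisym; n≤1+n; m≤n⇒m≤1+n; +-mono-≤; +-suc;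
         +-identityʳ; m^n>0; suc-injective; 0≢1+n; 1+n≢0)
open import Data.List using (List; []; _∷_; [_]; _∷ʳ_; length; reverse; drop)
open import Data.List.Properties using (unfold-reverse; reverse-++; reverse-involutive; length-reverse)
open import Data.List.Reverse using ([]; _∶_∶ʳ_; reverseView)
open import Data.List.Membership.Propositional using (_∈_)
open import Data.List.Relation.Unary.Any using (here; there)
import Data.List.Relation.Unary.Any.Properties as Any
open import Data.List.Relation.Unary.All as All using (All)
open import Data.List.Relation.Binary.Subset.Propositional using (_⊆_)
open import Data.List.Relation.Binary.Subset.Propositional.Properties using (⊆-refl; xs⊆x∷xs)
open import Data.List.Relation.Binary.Disjoint.Propositional renaming (Disjoint to Disjoint∈)
open import Data.Product using (∃-syntax; _×_; _,_; proj₁; proj₂)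
open import Data.Unit using (⊤; tt)
open import Function using (_∘_)
open import Relation.Nullary using (yes; no; contradiction)
open import Relation.Binary.PropositionalEquality
  using (_≡_; _≢_; refl; sym; trans; cong; subst; subst₂; ≢-sym; module ≡-Reasoning)

private
  variable
    P : ℕ → Set
    S T : List ℕ → Set
    k m n r : ℕ
    x y z c c' p q v w : ℕ
    a a' b b' l t u u' : List ℕ

2^[1+k]∸1 : ∀ k → 2 ^ suc k ∸ 1 ≡ suc ((2 ^ k ∸ 1) + (2 ^ k ∸ 1))
2^[1+k]∸1 k with 2 ^ k | m^n>0 2 k
... | suc m | _ = begin
  m + suc (m + 0)   ≡⟨ +-suc m (m + 0) ⟩
  suc (m + (m + 0)) ≡⟨ cong (suc ∘ (m +_)) (+-identityʳ m) ⟩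
  suc (m + m)       ∎
  where open ≡-Reasoning

doubling-≤ : ∀ k → 2 ^ k ∸ 1 ≤ m → suc (m + m) ≤ n → 2 ^ suc k ∸ 1 ≤ n
doubling-≤ {n = n} k h le = subst (_≤ n) (sym (2^[1+k]∸1 k)) (≤-trans (s≤s (+-mono-≤ h h)) le)

doubling-≥ : ∀ k → m ≤ 2 ^ k ∸ 1 → suc (m + m) ≤ 2 ^ suc k ∸ 1
doubling-≥ {m} k h = subst (suc (m + m) ≤_) (sym (2^[1+k]∸1 k)) (s≤s (+-mono-≤ h h))

Disjoint∈-mono : a ⊆ a' → b ⊆ b' → Disjoint∈ a' b' → Disjoint∈ a b
Disjoint∈-mono a⊆a' b⊆b' a'#b' (z∈a , z∈b) = a'#b' (a⊆a' z∈a , b⊆b' z∈b)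

NoAdjRepeat-tail : NoAdjRepeat (x ∷ l) → NoAdjRepeat l
NoAdjRepeat-tail (one _)    = nil
NoAdjRepeat-tail (cons _ r) = r

NoAdjRepeat-∷ʳ : ∀ l → NoAdjRepeat (l ∷ʳ y) → y ≢ x → NoAdjRepeat (l ∷ʳ y ∷ʳ x)
NoAdjRepeat-∷ʳ []          _            y≢x = cons y≢x (one _)
NoAdjRepeat-∷ʳ (_ ∷ [])    (cons z≢y _) y≢x = cons z≢y (cons y≢x (one _))
NoAdjRepeat-∷ʳ (_ ∷ w ∷ l) (cons z≢w r) y≢x = cons z≢w (NoAdjRepeat-∷ʳ (w ∷ l) r y≢x)

NoAdjRepeat-reverse : NoAdjRepeat l → NoAdjRepeat (reverse l)
NoAdjRepeat-reverse nil     = nil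
NoAdjRepeat-reverse (one x) = one x
NoAdjRepeat-reverse (cons {x} {y} {l} x≢y r) =
  subst NoAdjRepeat (sym (trans (unfold-reverse x (y ∷ l)) (cong (_∷ʳ x) (unfold-reverse y l))))
    (NoAdjRepeat-∷ʳ (reverse l) (subst NoAdjRepeat (unfold-reverse y l) (NoAdjRepeat-reverse r)) (≢-sym x≢y))

All-reverse : All P l → All P (reverse l)
All-reverse ps = All.tabulate (All.lookup ps ∘ Any.reverse⁻)

altSwap-head : ∀ p q l → altSwap p q (p ∷ l) ≡ q ∷ altSwap q p l
altSwap-head p q l with p ≟ p
... | yes _   = refl
... | no p≢p = contradiction refl p≢p

altSwap-other : ∀ l → z ≢ p → altSwap p q (z ∷ l) ≡ z ∷ l
altSwap-other {z} {p} l z≢p with z ≟ p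
... | yes z≡p = contradiction z≡p z≢p
... | no _    = refl

altSwap-noRep : ∀ l → NoAdjRepeat (p ∷ l) → altSwap p q l ≡ l
altSwap-noRep []      _            = refl
altSwap-noRep (_ ∷ l) (cons p≢z _) = altSwap-other l (≢-sym p≢z)

altSwap-inverse : ∀ l → NoAdjRepeat (q ∷ l) → altSwap q p (altSwap p q l) ≡ l
altSwap-inverse []      _ = refl
altSwap-inverse {p = p} (z ∷ l) (cons q≢z r) with z ≟ p
... | yes refl = trans (altSwap-head _ z _) (cong (z ∷_) (altSwap-inverse l r))
... | no _     = altSwap-other l (≢-sym q≢z)

altSwap-⊆ : ∀ l → altSwap p q l ⊆ q ∷ l
altSwap-⊆ []      ()
altSwap-⊆ {p} (z ∷ l) z∈ with z ≟ p
altSwap-⊆ (z ∷ l) (here refl)  | yes _    = here refl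
altSwap-⊆ (z ∷ l) (there z∈)   | yes refl with altSwap-⊆ l z∈
... | here refl  = there (here refl)
... | there z∈l = there (there z∈l)
altSwap-⊆ (z ∷ l) z∈           | no _     = there z∈

involutionRev-∷∷ : ∀ y x l → involutionRev (y ∷ x ∷ l) ≡ x ∷ y ∷ altSwap y x l
involutionRev-∷∷ y x l = trans (altSwap-head y x (x ∷ l)) (cong (x ∷_) (altSwap-head x y l))

data RevMove : List ℕ → List ℕ → Set where
  adjust  : ∀ l → x ≢ v → RevMove (x ∷ l) (v ∷ l)
  involve : ∀ l → RevMove (y ∷ x ∷ l) (x ∷ y ∷ altSwap y x l)

data RevSolves (S : List ℕ → Set) : ℕ → List ℕ → List ℕ → Set where
  done : ∀ {a} → S a → RevSolves S 0 a a
  step : ∀ {n a b t} → S a → RevMove a b → RevSolves S n b t → RevSolves S (suc n) a t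

source-valid : RevSolves S n a b → S a
source-valid (done s)     = s
source-valid (step s _ _) = s

RevMove-involutionRev : ∀ l → 2 ≤ length l → RevMove l (involutionRev l)
RevMove-involutionRev (y ∷ x ∷ l) _ = subst (RevMove _) (sym (involutionRev-∷∷ y x l)) (involve l)
RevMove-involutionRev (_ ∷ []) (s≤s ())

Move⇒RevMove : Move a b → RevMove (reverse a) (reverse b)
Move⇒RevMove (adjustment init x v x≢v) =
  subst₂ RevMove (sym (reverse-++ init [ x ])) (sym (reverse-++ init [ v ])) (adjust (reverse init) x≢v)
Move⇒RevMove (involve a 2≤∣a∣) =
  subst (RevMove (reverse a)) (sym (reverse-involutive _))
    (RevMove-involutionRev (reverse a) (subst (2 ≤_) (sym (length-reverse a)) 2≤∣a∣))

RevMove⇒Move : RevMove a b → Move (reverse a) (reverse b)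
RevMove⇒Move (adjust {x} {v} l x≢v) =
  subst₂ Move (sym (unfold-reverse x l)) (sym (unfold-reverse v l)) (adjustment (reverse l) x v x≢v)
RevMove⇒Move {a = a@(y ∷ x ∷ l)} (involve _) =
  subst (Move (reverse a))
    (trans (cong (reverse ∘ involutionRev) (reverse-involutive a)) (cong reverse (involutionRev-∷∷ y x l)))
    (involve (reverse a) (subst (2 ≤_) (sym (length-reverse a)) (s≤s (s≤s z≤n))))

Solves⇒RevSolves : (∀ {a} → S a → T (reverse a)) → Solves S n a b → RevSolves T n (reverse a) (reverse b)
Solves⇒RevSolves f (done s)          = done (f s)
Solves⇒RevSolves f (step s move sol) = step (f s) (Move⇒RevMove move) (Solves⇒RevSolves f sol)

RevSolves⇒Solves : (∀ {a} → T a → S (reverse a)) → RevSolves T n a b → Solves S n (reverse a) (reverse b)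
RevSolves⇒Solves f (done s)          = done (f s)
RevSolves⇒Solves f (step s move sol) = step (f s) (RevMove⇒Move move) (RevSolves⇒Solves f sol)

-- States of the game with unbounded entries; the lower bound already holds there.
FreeState : ℕ → List ℕ → Set
FreeState k l = length l ≡ k × NoAdjRepeat l

FreeState-drop1 : FreeState (suc k) l → FreeState k (drop 1 l)
FreeState-drop1 {l = _ ∷ _} (len , r) = suc-injective len , NoAdjRepeat-tail r

drop1-⊆ : ∀ (l : List ℕ) → drop 1 l ⊆ l
drop1-⊆ []      ()
drop1-⊆ (x ∷ l) = xs⊆x∷xs l x

swapTop-⊇ : NoAdjRepeat (x ∷ l) → y ∷ x ∷ l ⊆ x ∷ y ∷ altSwap y x l
swapTop-⊇ _ (here refl)         = there (here refl)
swapTop-⊇ _ (there (here refl)) = here refl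
swapTop-⊇ {x} {l} {y} r (there (there z∈l)) =
  there (altSwap-⊆ (altSwap y x l) (subst (_ ∈_) (sym (altSwap-inverse l r)) z∈l))

swappedTail-⊆ : ∀ l → y ∷ altSwap y x l ⊆ y ∷ x ∷ l
swappedTail-⊆ l (here refl) = here refl
swappedTail-⊆ l (there z∈)  = there (altSwap-⊆ l z∈)

involution-moves-tail : NoAdjRepeat (v ∷ x ∷ l) → RevMove (x ∷ l) (v ∷ altSwap v x l)
involution-moves-tail {l = []}        (cons v≢x _) = adjust [] (≢-sym v≢x)
involution-moves-tail {v} {l = z ∷ l} (cons v≢x _) with z ≟ v
... | yes refl = involve l
... | no _     = adjust (z ∷ l) (≢-sym v≢x)

-- A solution in the game on k + 1 entries, read on its lower k entries and scanned from the
-- end: the lower entries stay put, or they follow a solution with m moves starting from the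
-- tail of a, or from the tail of a after one involution.  Between two moves of the lower
-- entries there must be an adjustment, which is where the bound 2m + 1 ≤ n comes from.  The
-- target is only remembered up to its set of entries.
data TailShadow (k n : ℕ) (b : List ℕ) : List ℕ → Set where
  unmoved          : a ⊆ b → TailShadow k n b a
  via-tail         : suc (m + m) ≤ n → b' ⊆ b →
                     RevSolves (FreeState k) m (drop 1 a) (drop 1 b') → TailShadow k n b a
  via-swapped-tail : suc (suc (m + m)) ≤ n → b' ⊆ b →
                     RevSolves (FreeState k) m (y ∷ altSwap y x l) (drop 1 b') → TailShadow k n b (y ∷ x ∷ l)

shadow : RevSolves (FreeState (suc k)) n a b → TailShadow k n b a
shadow (done _) = unmoved ⊆-refl
shadow (step sa (adjust _ _) rest) with shadow rest
... | unmoved ⊆b          = via-tail (s≤s z≤n) ⊆b (done (FreeState-drop1 sa))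
... | via-tail le ⊆b sol = via-tail (m≤n⇒m≤1+n le) ⊆b sol
... | via-swapped-tail {m = m} le ⊆b sol =
  via-tail (s≤s (≤-trans (≤-reflexive (cong suc (+-suc m m))) le)) ⊆b
    (step (FreeState-drop1 sa) (involution-moves-tail (proj₂ (source-valid rest))) sol)
shadow (step (_ , r) (involve l) rest) with shadow rest
... | unmoved ⊆b          = unmoved (⊆b ∘ swapTop-⊇ (NoAdjRepeat-tail r))
... | via-tail le ⊆b sol = via-swapped-tail (s≤s le) ⊆b sol
... | via-swapped-tail le ⊆b sol =
  via-tail (≤-trans (n≤1+n _) (m≤n⇒m≤1+n le)) ⊆b
    (subst (λ t → RevSolves _ _ (_ ∷ t) _) (altSwap-inverse l (NoAdjRepeat-tail r)) sol)

lower-bound : ∀ k {n a b} → RevSolves (FreeState k) n a b → Disjoint∈ a b → 2 ^ k ∸ 1 ≤ n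
lower-bound zero    _   _   = z≤n
lower-bound (suc k) {a = []} sol _ = contradiction (proj₁ (source-valid sol)) 0≢1+n
lower-bound (suc k) {a = a@(_ ∷ _)} sol a#b with shadow sol
... | unmoved a⊆b        = contradiction (here refl , a⊆b (here refl)) a#b
... | via-tail le ⊆b sol' =
  doubling-≤ k (lower-bound k sol' (Disjoint∈-mono (drop1-⊆ a) (⊆b ∘ drop1-⊆ _) a#b)) le
... | via-swapped-tail {l = l} le ⊆b sol' =
  doubling-≤ k (lower-bound k sol' (Disjoint∈-mono (swappedTail-⊆ l) (⊆b ∘ drop1-⊆ _) a#b)) (≤-trans (n≤1+n _) le)

data Bottom (P : ℕ → Set) : List ℕ → Set where
  []   : Bottom P []
  last : P x → Bottom P (x ∷ [])
  _∷_  : ∀ y → Bottom P (x ∷ l) → Bottom P (y ∷ x ∷ l)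

Bottom-tail : Bottom P (x ∷ l) → Bottom P l
Bottom-tail (last _) = []
Bottom-tail (_ ∷ β)  = β

Bottom-∷ʳ⁺ : ∀ l → P x → Bottom P (l ∷ʳ x)
Bottom-∷ʳ⁺ []          px = last px
Bottom-∷ʳ⁺ (y ∷ [])    px = y ∷ last px
Bottom-∷ʳ⁺ (y ∷ z ∷ l) px = y ∷ Bottom-∷ʳ⁺ (z ∷ l) px

Bottom-∷ʳ⁻ : ∀ l → Bottom P (l ∷ʳ x) → P x
Bottom-∷ʳ⁻ []          (last px) = px
Bottom-∷ʳ⁻ (_ ∷ [])    (_ ∷ β)   = Bottom-∷ʳ⁻ [] β
Bottom-∷ʳ⁻ (_ ∷ z ∷ l) (_ ∷ β)   = Bottom-∷ʳ⁻ (z ∷ l) β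

Bottom-⊤ : ∀ l → Bottom (λ _ → ⊤) l
Bottom-⊤ []          = []
Bottom-⊤ (_ ∷ [])    = last tt
Bottom-⊤ (y ∷ x ∷ l) = y ∷ Bottom-⊤ (x ∷ l)

-- A Hanoi state of 𝓗_{r,k} read backwards, with P imposed on its bottom entry x₁:
-- P = λ _ → ⊤ gives 𝓗_{r,k} and P = _≢ 0 gives 𝓗*_{r,k}.
record RevHanoi (P : ℕ → Set) (r k : ℕ) (l : List ℕ) : Set where
  field
    len    : length l ≡ k
    range  : All (_≤ r) l
    noRep  : NoAdjRepeat l
    bottom : Bottom P l
open RevHanoi

RevHanoi-tail : RevHanoi P r (suc k) (x ∷ l) → RevHanoi P r k l
RevHanoi-tail h = record
  { len = suc-injective (len h) ; range = All.tail (range h)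
  ; noRep = NoAdjRepeat-tail (noRep h) ; bottom = Bottom-tail (bottom h) }

RevHanoi-∷ : RevHanoi P r k (x ∷ l) → c ≤ r → c ≢ x → RevHanoi P r (suc k) (c ∷ x ∷ l)
RevHanoi-∷ {c = c} h c≤r c≢x = record
  { len = cong suc (len h) ; range = c≤r All.∷ range h
  ; noRep = cons c≢x (noRep h) ; bottom = c ∷ bottom h }

RevSolvesWithin : (List ℕ → Set) → ℕ → List ℕ → List ℕ → Set
RevSolvesWithin S n a b = ∃[ m ] m ≤ n × RevSolves S m a b

RevSolvesWithin-mono : m ≤ n → RevSolvesWithin S m a b → RevSolvesWithin S n a b
RevSolvesWithin-mono m≤n (k , k≤m , sol) = k , ≤-trans k≤m m≤n , sol

step-within : S a → RevMove a b → RevSolvesWithin S n b t → RevSolvesWithin S (suc n) a t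
step-within sa move (m , m≤n , sol) = suc m , s≤s m≤n , step sa move sol

adjust-within : S (c ∷ u) → RevSolvesWithin S n (w ∷ u) t → RevSolvesWithin S (suc n) (c ∷ u) t
adjust-within {c = c} {w = w} sc sol with c ≟ w
... | yes refl = RevSolvesWithin-mono (n≤1+n _) sol
... | no c≢w   = step-within sc (adjust _ c≢w) sol

RevMove-head-≢ : NoAdjRepeat (p ∷ t) → RevMove (p ∷ t) (w ∷ u) → p ≢ w
RevMove-head-≢ _            (adjust _ p≢w) = p≢w
RevMove-head-≢ (cons p≢w _) (involve _)    = p≢w

-- The simulating move: from the state with w on top of the lower entries (p ∷ t), one
-- involution carries out the lower move and leaves p on top.
RevMove-RevSolves-lift : NoAdjRepeat (w ∷ u) → RevMove (p ∷ t) (w ∷ u) → RevMove (w ∷ p ∷ t) (p ∷ w ∷ u)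
RevMove-RevSolves-lift {w} {p = p} r (adjust t _) =
  subst (λ s → RevMove (w ∷ p ∷ t) (p ∷ w ∷ s)) (altSwap-noRep t r) (involve t)
RevMove-RevSolves-lift {w} {p = p} _ (involve l) =
  subst (λ s → RevMove (w ∷ p ∷ w ∷ l) (p ∷ w ∷ s)) (altSwap-head w p l) (involve (w ∷ l))

RevSolves-lift : RevSolves (RevHanoi P r k) m u u' →
       RevHanoi P r (suc k) (c ∷ u) → RevHanoi P r (suc k) (c' ∷ u') →
       RevSolvesWithin (RevHanoi P r (suc k)) (suc (m + m)) (c ∷ u) (c' ∷ u')
RevSolves-lift (done _) hc hc' = adjust-within hc (0 , z≤n , done hc')
RevSolves-lift (step {a = []} _ () _) _ _
RevSolves-lift (step {b = []} _ () _) _ _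
RevSolves-lift (step {n = m} {a = p ∷ t} {b = w ∷ u} hu move rest) hc hc' =
  RevSolvesWithin-mono (s≤s (s≤s (≤-reflexive (sym (+-suc m m)))))
    (adjust-within hc
      (step-within (RevHanoi-∷ hu (All.head (range hw)) (≢-sym p≢w)) (RevMove-RevSolves-lift (noRep hw) move)
        (RevSolves-lift rest (RevHanoi-∷ hw (All.head (range hu)) p≢w) hc')))
  where
  hw = source-valid rest
  p≢w = RevMove-head-≢ (noRep hu) move

upper-bound : RevHanoi P r k a → RevHanoi P r k b → Disjoint∈ a b →
             RevSolvesWithin (RevHanoi P r k) (2 ^ k ∸ 1) a b
upper-bound {k = zero}  {a = []}    {b = []}     ha _  _   = 0 , z≤n , done ha
upper-bound {k = suc k} {a = _ ∷ u} {b = _ ∷ u'} ha hb a#b =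
  let m , m≤ , sol = upper-bound (RevHanoi-tail ha) (RevHanoi-tail hb)
                                (Disjoint∈-mono (xs⊆x∷xs u _) (xs⊆x∷xs u' _) a#b)
  in RevSolvesWithin-mono (doubling-≥ k m≤) (RevSolves-lift sol ha hb)
upper-bound {k = zero}  {a = _ ∷ _}              ha _ _ = contradiction (len ha) 1+n≢0
upper-bound {k = zero}  {a = []}    {b = _ ∷ _}  _ hb _ = contradiction (len hb) 1+n≢0
upper-bound {k = suc _} {a = []}                 ha _ _ = contradiction (len ha) 0≢1+n
upper-bound {k = suc _} {a = _ ∷ _} {b = []}     _ hb _ = contradiction (len hb) 0≢1+n

Hanoi⇒FreeState : Hanoi r k a → FreeState k (reverse a)
Hanoi⇒FreeState {a = a} h = trans (length-reverse a) (Hanoi.len h) , NoAdjRepeat-reverse (Hanoi.noRep h)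

Hanoi⇒RevHanoi : Hanoi r k a → Bottom P (reverse a) → RevHanoi P r k (reverse a)
Hanoi⇒RevHanoi h β = record
  { len = proj₁ (Hanoi⇒FreeState h) ; range = All-reverse (Hanoi.range h)
  ; noRep = proj₂ (Hanoi⇒FreeState h) ; bottom = β }

RevHanoi⇒Hanoi : RevHanoi P r k l → Hanoi r k (reverse l)
RevHanoi⇒Hanoi {l = l} h = record
  { len = trans (length-reverse l) (len h) ; range = All-reverse (range h)
  ; noRep = NoAdjRepeat-reverse (noRep h) }

Bottom-reverse : FirstNonzero a → Bottom (_≢ 0) (reverse a)
Bottom-reverse {a = x ∷ l} (fnz x≢0) =
  subst (Bottom _) (sym (unfold-reverse x l)) (Bottom-∷ʳ⁺ (reverse l) x≢0)

FirstNonzero-reverse : length l ≡ suc k → Bottom (_≢ 0) l → FirstNonzero (reverse l)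
FirstNonzero-reverse {l} len β with reverseView l
... | []          = contradiction len 0≢1+n
... | xs ∶ _ ∶ʳ x = subst FirstNonzero (sym (reverse-++ xs [ x ])) (fnz (Bottom-∷ʳ⁻ xs β))

RevHanoi⇒ProperHanoi : RevHanoi (_≢ 0) r (suc k) l → ProperHanoi r (suc k) (reverse l)
RevHanoi⇒ProperHanoi h = RevHanoi⇒Hanoi h , FirstNonzero-reverse (len h) (bottom h)

Disjoint-reverse : Disjoint a b → Disjoint∈ (reverse a) (reverse b)
Disjoint-reverse a#b (z∈a , z∈b) = All.lookup (All.lookup a#b (Any.reverse⁻ z∈a)) (Any.reverse⁻ z∈b) refl

requires-exactly : ∀ k {S T : List ℕ → Set} {a b} →
                  (∀ {a} → S a → FreeState k (reverse a)) → (∀ {l} → T l → S (reverse l)) →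
                  Disjoint∈ (reverse a) (reverse b) → RevSolvesWithin T (2 ^ k ∸ 1) (reverse a) (reverse b) →
                  RequiresExactly S (2 ^ k ∸ 1) a b
requires-exactly k {S} {a = a} {b} toFree fromT a#b (m , m≤ , sol) =
  subst (λ n → Solves S n a b) (≤-antisym m≤ (optimal m solution)) solution , optimal
  where
  optimal : ∀ n → Solves S n a b → 2 ^ k ∸ 1 ≤ n
  optimal _ s = lower-bound k (Solves⇒RevSolves toFree s) a#b
  solution : Solves S m a b
  solution = subst₂ (Solves S m) (reverse-involutive a) (reverse-involutive b) (RevSolves⇒Solves fromT sol)

lemma6 : (r k : ℕ) → 1 ≤ r → 1 ≤ k → (a b : List ℕ) → Disjoint a b →
           (Hanoi r k a → Hanoi r k b → RequiresExactly (Hanoi r k) (2 ^ k ∸ 1) a b)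
           × (ProperHanoi r k a → ProperHanoi r k b → RequiresExactly (ProperHanoi r k) (2 ^ k ∸ 1) a b)
lemma6 r (suc k) _ (s≤s z≤n) a b a#b =
  (λ ha hb → requires-exactly (suc k) Hanoi⇒FreeState RevHanoi⇒Hanoi ra#rb
               (upper-bound (Hanoi⇒RevHanoi ha (Bottom-⊤ _)) (Hanoi⇒RevHanoi hb (Bottom-⊤ _)) ra#rb)) ,
  (λ (ha , fa) (hb , fb) → requires-exactly (suc k) (Hanoi⇒FreeState ∘ proj₁) RevHanoi⇒ProperHanoi ra#rb
               (upper-bound (Hanoi⇒RevHanoi ha (Bottom-reverse fa)) (Hanoi⇒RevHanoi hb (Bottom-reverse fb)) ra#rb))
  where
  ra#rb : Disjoint∈ (reverse a) (reverse b)
  ra#rb = Disjoint-reverse a#b
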